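{- For $n\ge1$ there is a bijection $\phi$ between the set of permutations $\sigma$ of $[n]$ and the set of increasing trees $T$ on $\{0,1,\dots,n\}$ such that the number of up-down runs of $\sigma$ equals the number of nonroot vertices of $\phi(\sigma)$ of even degree.
   Context: An increasing tree on $\{0,1,\dots,n\}$ is a rooted tree with vertex set $\{0,1,\dots,n\}$, root $0$, in which every child is larger than its parent (children unordered). The degree of a vertex is its number of children (so leaves have even degree $0$). For a permutation $\sigma$ of $[n]$, prepend $\sigma_0=0$; an up-down run is a maximal increasing or decreasing segment of consecutive entries of $\sigma_0\sigma_1\cdots\sigma_n$ (e.g. $2\,1$ has two up-down runs $0\,2$ and $2\,1$). -}

module Defs where

open import Data.Nat using (ℕ; zero; suc; _<ᵇ_; _≡ᵇ_)
open import Data.Bool using (Bool; true; false; _∧_; not; if_then_else_; T)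
open import Data.List using (List; []; _∷_; length; reverse; map; upTo; filter)
open import Data.Vec using (Vec; toList)
open import Data.Fin using (Fin; toℕ)
open import Data.Product using (Σ; _,_)
open import Data.Nat using (_≟_)
import Data.Bool

_==_ : Bool → Bool → Bool
true  == b = b
false == b = not b

elemᵇ : ℕ → List ℕ → Bool
elemᵇ x []       = false
elemᵇ x (y ∷ ys) = if x ≡ᵇ y then true else elemᵇ x ys

allDistinct : List ℕ → Bool
allDistinct []       = true
allDistinct (x ∷ xs) = not (elemᵇ x xs) ∧ allDistinct xs

-- Permutations of [n] = {1,…,n}, in one-line notation σ₁ … σₙ.
-- Entry i (0-based) of the vector is σ_{i+1} - 1 ∈ Fin n; the entries
-- must be pairwise distinct (hence a bijection [n] → [n]).
-- The T-proof is a unit type, so equality of permutations is equality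
-- of the one-line words.

oneLine : ∀ {n} → Vec (Fin n) n → List ℕ
oneLine v = map (λ i → suc (toℕ i)) (toList v)

Perm : ℕ → Set
Perm n = Σ (Vec (Fin n) n) (λ v → T (allDistinct (oneLine v)))

-- Up-down runs: maximal monotone segments of a sequence of distinct
-- naturals (consecutive runs share their common endpoint).
-- go d cur last rest : current run `cur` (stored reversed, last entry
-- `last`) has direction d (true = increasing); `rest` is still unread.

go : Bool → List ℕ → ℕ → List ℕ → List (List ℕ)
go d cur last []         = reverse cur ∷ []
go d cur last (z ∷ rest) =
  if (last <ᵇ z) == d
  then go d (z ∷ cur) z rest
  else reverse cur ∷ go (not d) (z ∷ last ∷ []) z rest

upDownRuns : List ℕ → List (List ℕ)
upDownRuns (x ∷ y ∷ rest) = go (x <ᵇ y) (y ∷ x ∷ []) y rest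
upDownRuns _              = []

-- number of up-down runs of σ, with σ₀ = 0 prepended
runCount : ∀ {n} → Perm n → ℕ
runCount (v , _) = length (upDownRuns (0 ∷ oneLine v))

-- Increasing trees on {0,1,…,n} with root 0, children unordered,
-- encoded by the parent map: entry i (0-based) of the vector is the
-- parent of vertex i+1, and it must be smaller than i+1.
-- (A rooted tree on a vertex set is determined by its parent map;
-- every map with parent(v) < v for v ≥ 1 defines such a tree.)

parentsOK : ℕ → List ℕ → Bool
parentsOK k []       = true
parentsOK k (p ∷ ps) = (p <ᵇ suc k) ∧ parentsOK (suc k) ps

IncTree : ℕ → Set
IncTree n = Σ (Vec ℕ n) (λ p → T (parentsOK 0 (toList p)))

degree : ∀ {n} → IncTree n → ℕ → ℕ
degree (p , _) v = length (filter (λ u → u ≟ v) (toList p))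

isEven : ℕ → Bool
isEven zero          = true
isEven (suc zero)    = false
isEven (suc (suc k)) = isEven k

evenNonroot : ∀ {n} → IncTree n → ℕ
evenNonroot {n} t =
  length (filter (λ v → Data.Bool._≟_ (isEven (degree t v)) true)
                 (map suc (upTo n)))

-- Both families are built one element at a time.  A permutation of [m+1] is a
-- permutation σ of [m] together with the slot of 0 σ₁ ⋯ σₘ where m+1 is
-- inserted, and an increasing tree on {0,…,m+1} is a tree t on {0,…,m} together
-- with the parent of the new leaf m+1; either way there are m+1 choices, and each
-- raises the statistic by 0, 1 or 2.  Attaching the leaf to the root gains 1, to a
-- vertex of even degree 0 and to one of odd degree 2, so exactly evenNonroot t
-- choices gain 0 and one gains 1.  Likewise exactly runCount σ slots gain 0 and
-- one gains 1.  So if σ ↦ t preserves the statistic, the gains of the two sets of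
-- choices agree as multisets, and pairing choices of equal gain extends the
-- bijection from size m to size m+1.

module Submission where

open import Defs
open import Data.Bool.Base using (Bool; true; false; not; T; _∧_; if_then_else_)
open import Data.Bool.Properties using (T-∧; T-≡; T-irrelevant; ∧-assoc; ∧-identityʳ) renaming (_≟_ to _≟ᴮ_)
open import Data.Fin.Base using (Fin; zero; suc; toℕ; fromℕ; fromℕ<; inject₁; lower₁; punchIn; punchOut)
import Data.Fin.Properties as Fin
open import Data.Fin.Permutation using (Permutation′; _⟨$⟩ʳ_; insert; insert-punchIn; id)
open import Data.List.Base using (List; []; _∷_; [_]; _++_; length; filter; applyUpTo)
import Data.List.Base as List
open import Data.List.Properties using (filter-++; length-++; filter-none; map-applyUpTo; length-map)
open import Data.List.Relation.Unary.All using (All; []; _∷_)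
import Data.List.Relation.Unary.All as All
open import Data.Maybe.Base using (Maybe; just; nothing)
open import Data.Nat.Base using (ℕ; zero; suc; _+_; _≤_; _<_; _<ᵇ_; _≡ᵇ_; s≤s; z<s)
open import Data.Nat.Properties using (_≟_; +-comm; +-assoc; +-suc; +-identityʳ; +-cancelˡ-≡; +-commutativeSemigroup; <⇒<ᵇ; <ᵇ⇒<; ≡ᵇ⇒≡; ≡⇒≡ᵇ; <⇒≢; <⇒≯; <-≤-trans; m≤m+n)
open import Algebra.Properties.CommutativeSemigroup +-commutativeSemigroup using (x∙yz≈y∙xz)
open import Data.Product.Base using (Σ; Σ-syntax; ∃; _×_; _,_; proj₁; proj₂; uncurry)
open import Data.Product.Function.Dependent.Propositional using (Σ-↔)
open import Data.Sum.Base using (_⊎_; inj₁; inj₂)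
open import Data.Vec.Base using (Vec; []; _∷_; lookup; tabulate; toList; _∷ʳ_; init; last; initLast)
import Data.Vec.Base as Vec
open import Data.Vec.Properties using (toList-∷ʳ; length-toList; init-∷ʳ; last-∷ʳ; tabulate∘lookup; tabulate-cong; lookup∘tabulate; insertAt-lookup; insertAt-punchIn; lookup-map)
open import Function.Base using (_∘_; case_of_)
open import Function.Bundles using (_⇔_; Equivalence; _↔_; _⤖_; Bijection; Inverse; mk↔ₛ′; mk⇔)
open import Function.Definitions using (Injective)
open import Function.Properties.Inverse using (↔-sym; ↔-trans; ↔⇒⤖)
open import Relation.Binary.Definitions using (DecidableEquality)
open import Relation.Binary.PropositionalEquality using (_≡_; _≢_; refl; sym; trans; cong; cong₂; subst; module ≡-Reasoning)
open import Relation.Nullary.Decidable.Core using (⌊_⌋; toWitness; fromWitness; yes; no)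
open import Relation.Nullary.Negation using (¬_; contradiction)

<⇒<ᵇ≡true : ∀ {m n} → m < n → (m <ᵇ n) ≡ true
<⇒<ᵇ≡true m<n = Equivalence.to T-≡ (<⇒<ᵇ m<n)

>⇒<ᵇ≡false : ∀ {m n} → n < m → (m <ᵇ n) ≡ false
>⇒<ᵇ≡false {m} {n} n<m with m <ᵇ n in eq
... | true  = contradiction (<ᵇ⇒< m n (Equivalence.from T-≡ eq)) (<⇒≯ n<m)
... | false = refl

≡ᵇ-refl : ∀ n → (n ≡ᵇ n) ≡ true
≡ᵇ-refl n = Equivalence.to T-≡ (≡⇒≡ᵇ n n refl)

≢⇒≡ᵇ-false : ∀ {n} {i j : Fin n} → i ≢ j → (toℕ i ≡ᵇ toℕ j) ≡ false
≢⇒≡ᵇ-false {i = i} {j} i≢j with toℕ i ≡ᵇ toℕ j in eq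
... | true  = contradiction (Fin.toℕ-injective (≡ᵇ⇒≡ (toℕ i) (toℕ j) (Equivalence.from T-≡ eq))) i≢j
... | false = refl

T-not⇒¬T : ∀ {b} → T (not b) → ¬ T b
T-not⇒¬T {true} ()

isEven-suc : ∀ d → isEven (suc d) ≡ not (isEven d)
isEven-suc zero          = refl
isEven-suc (suc zero)    = refl
isEven-suc (suc (suc d)) = isEven-suc d

Σ-T-≡ : ∀ {A : Set} {P : A → Bool} {x y : A} {px : T (P x)} {py : T (P y)} →
        x ≡ y → _≡_ {A = Σ A (T ∘ P)} (x , px) (y , py)
Σ-T-≡ {px = px} {py} refl = cong (_ ,_) (T-irrelevant px py)

lookup-extensionality : ∀ {A : Set} {n} (xs ys : Vec A n) → (∀ i → lookup xs i ≡ lookup ys i) → xs ≡ ys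
lookup-extensionality xs ys xs≗ys = trans (sym (tabulate∘lookup xs)) (trans (tabulate-cong xs≗ys) (tabulate∘lookup ys))

punchIn-cases : ∀ {n} (p k : Fin (suc n)) → k ≡ p ⊎ ∃ λ j → punchIn p j ≡ k
punchIn-cases p k with p Fin.≟ k
... | yes p≡k = inj₁ (sym p≡k)
... | no  p≢k = inj₂ (punchOut p≢k , Fin.punchIn-punchOut p≢k)

-- Counting over Fin

⟦_⟧ : Bool → ℕ
⟦ true ⟧  = 1
⟦ false ⟧ = 0

count : ∀ {N} → (Fin N → Bool) → ℕ
count {zero}  P = 0
count {suc N} P = ⟦ P zero ⟧ + count (P ∘ suc)

count-cong : ∀ {N} {P Q : Fin N → Bool} → (∀ i → P i ≡ Q i) → count P ≡ count Q
count-cong {zero}  P≗Q = refl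
count-cong {suc N} P≗Q = cong₂ _+_ (cong ⟦_⟧ (P≗Q zero)) (count-cong (P≗Q ∘ suc))

count-punchIn : ∀ {N} (P : Fin (suc N) → Bool) j → count P ≡ ⟦ P j ⟧ + count (P ∘ punchIn j)
count-punchIn P zero = refl
count-punchIn {suc N} P (suc j) =
  trans (cong (⟦ P zero ⟧ +_) (count-punchIn (P ∘ suc) j)) (x∙yz≈y∙xz ⟦ P zero ⟧ ⟦ P (suc j) ⟧ _)

0<count⇒∃ : ∀ {N} (P : Fin N → Bool) → 0 < count P → ∃ λ i → T (P i)
0<count⇒∃ {suc N} P 0<count with P zero in P0≡
... | true  = zero , Equivalence.from T-≡ P0≡
... | false = let i , Pi = 0<count⇒∃ (P ∘ suc) 0<count in suc i , Pi

T⇒0<count : ∀ {N} (P : Fin (suc N) → Bool) i → T (P i) → 0 < count P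
T⇒0<count P i Pi rewrite count-punchIn P i with P i | Pi
... | true | _ = z<s

count-last : ∀ {N} (P : Fin (suc N) → Bool) → count P ≡ count (P ∘ inject₁) + ⟦ P (fromℕ N) ⟧
count-last {zero}  P = +-comm ⟦ P zero ⟧ 0
count-last {suc N} P = trans (cong (⟦ P zero ⟧ +_) (count-last (P ∘ suc))) (sym (+-assoc ⟦ P zero ⟧ _ _))

count-none : ∀ {N} (P : Fin N → Bool) → (∀ i → P i ≡ false) → count P ≡ 0
count-none {zero}  P none = refl
count-none {suc N} P none rewrite none zero = count-none (P ∘ suc) (none ∘ suc)

module Multiplicity {A : Set} (_≟_ : DecidableEquality A) where

  isValue : ∀ {N} → (Fin N → A) → A → Fin N → Bool
  isValue f c i = ⌊ f i ≟ c ⌋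

  multiplicity : ∀ {N} → (Fin N → A) → A → ℕ
  multiplicity f c = count (isValue f c)

  -- Opaque: only its specification is used, and unfolding it makes the
  -- conversion checks of runEvenBijection-suc very slow.
  opaque
    rearrangement : ∀ {N} (f g : Fin N → A) → (∀ c → multiplicity f c ≡ multiplicity g c) →
                    Σ[ π ∈ Permutation′ N ] (∀ i → g (π ⟨$⟩ʳ i) ≡ f i)
    rearrangement {zero}  f g _    = id , λ ()
    rearrangement {suc N} f g same = insert zero j π , λ where
        zero    → gj≡f0
        (suc i) → trans (cong g (insert-punchIn zero j π i)) (proj₂ rest i)
      where
      f0∈g : ∃ λ j → T (⌊ g j ≟ f zero ⌋)
      f0∈g = 0<count⇒∃ (isValue g (f zero)) (subst (0 <_) (same (f zero))
               (T⇒0<count (isValue f (f zero)) zero (fromWitness {a? = f zero ≟ f zero} refl)))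
      j : Fin (suc N)
      j = proj₁ f0∈g
      gj≡f0 : g j ≡ f zero
      gj≡f0 = toWitness {a? = g j ≟ f zero} (proj₂ f0∈g)
      same′ : ∀ c → multiplicity (f ∘ suc) c ≡ multiplicity (g ∘ punchIn j) c
      same′ c = +-cancelˡ-≡ ⟦ ⌊ f zero ≟ c ⌋ ⟧ _ _ (begin
        multiplicity f c                                    ≡⟨ same c ⟩
        multiplicity g c                                    ≡⟨ count-punchIn (isValue g c) j ⟩
        ⟦ ⌊ g j ≟ c ⌋ ⟧ + multiplicity (g ∘ punchIn j) c    ≡⟨ cong (λ x → ⟦ ⌊ x ≟ c ⌋ ⟧ + multiplicity (g ∘ punchIn j) c) gj≡f0 ⟩
        ⟦ ⌊ f zero ≟ c ⌋ ⟧ + multiplicity (g ∘ punchIn j) c ∎)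
        where open ≡-Reasoning
      rest : Σ[ π ∈ Permutation′ N ] (∀ i → g (punchIn j (π ⟨$⟩ʳ i)) ≡ f (suc i))
      rest = rearrangement (f ∘ suc) (g ∘ punchIn j) same′
      π : Permutation′ N
      π = proj₁ rest

data Increment : Set where
  +0 +1 +2 : Increment

value : Increment → ℕ
value +0 = 0
value +1 = 1
value +2 = 2

_≟ᴵ_ : DecidableEquality Increment
+0 ≟ᴵ +0 = yes refl
+0 ≟ᴵ +1 = no λ ()
+0 ≟ᴵ +2 = no λ ()
+1 ≟ᴵ +0 = no λ ()
+1 ≟ᴵ +1 = yes refl
+1 ≟ᴵ +2 = no λ ()
+2 ≟ᴵ +0 = no λ ()
+2 ≟ᴵ +1 = no λ ()
+2 ≟ᴵ +2 = yes refl

open Multiplicity _≟ᴵ_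

multiplicity-total : ∀ {N} (f : Fin N → Increment) → multiplicity f +0 + (multiplicity f +1 + multiplicity f +2) ≡ N
multiplicity-total {zero}  f = refl
multiplicity-total {suc N} f with f zero | multiplicity-total (f ∘ suc)
... | +0 | total = cong suc total
... | +1 | total = trans (+-suc (multiplicity (f ∘ suc) +0) _) (cong suc total)
... | +2 | total = trans (cong (multiplicity (f ∘ suc) +0 +_) (+-suc (multiplicity (f ∘ suc) +1) _))
                         (trans (+-suc (multiplicity (f ∘ suc) +0) _) (cong suc total))

same-multiplicities : ∀ {N} (f g : Fin N → Increment) →
                      multiplicity f +0 ≡ multiplicity g +0 → multiplicity f +1 ≡ multiplicity g +1 →
                      ∀ c → multiplicity f c ≡ multiplicity g c
same-multiplicities f g same₀ same₁ +0 = same₀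
same-multiplicities f g same₀ same₁ +1 = same₁
same-multiplicities f g same₀ same₁ +2 =
  +-cancelˡ-≡ (multiplicity g +1) _ _ (+-cancelˡ-≡ (multiplicity g +0) _ _ (begin
    multiplicity g +0 + (multiplicity g +1 + multiplicity f +2)
      ≡⟨ cong₂ (λ a b → a + (b + multiplicity f +2)) (sym same₀) (sym same₁) ⟩
    multiplicity f +0 + (multiplicity f +1 + multiplicity f +2) ≡⟨ multiplicity-total f ⟩
    _                                                           ≡⟨ sym (multiplicity-total g) ⟩
    multiplicity g +0 + (multiplicity g +1 + multiplicity g +2) ∎))
  where open ≡-Reasoning


-- Increasing trees

parentsOK-++ : ∀ k L x → parentsOK k (L ++ [ x ]) ≡ parentsOK k L ∧ (x <ᵇ suc (k + length L))
parentsOK-++ k []      x = trans (∧-identityʳ _) (cong (λ n → x <ᵇ suc n) (sym (+-identityʳ k)))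
parentsOK-++ k (p ∷ L) x = begin
  (p <ᵇ suc k) ∧ parentsOK (suc k) (L ++ [ x ])
    ≡⟨ cong ((p <ᵇ suc k) ∧_) (parentsOK-++ (suc k) L x) ⟩
  (p <ᵇ suc k) ∧ (parentsOK (suc k) L ∧ (x <ᵇ suc (suc k + length L)))
    ≡⟨ sym (∧-assoc (p <ᵇ suc k) _ _) ⟩
  parentsOK k (p ∷ L) ∧ (x <ᵇ suc (suc k + length L))
    ≡⟨ cong (λ n → parentsOK k (p ∷ L) ∧ (x <ᵇ suc n)) (sym (+-suc k (length L))) ⟩
  parentsOK k (p ∷ L) ∧ (x <ᵇ suc (k + length (p ∷ L)))
    ∎
  where open ≡-Reasoning

parentsOK⇒All< : ∀ k L → T (parentsOK k L) → All (_< k + length L) L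
parentsOK⇒All< k []      _  = []
parentsOK⇒All< k (p ∷ L) ok = subst (λ n → All (_< n) (p ∷ L)) (sym (+-suc k (length L)))
  (<-≤-trans (<ᵇ⇒< p (suc k) (proj₁ ok′)) (m≤m+n (suc k) (length L)) ∷ parentsOK⇒All< (suc k) L (proj₂ ok′))
  where ok′ = Equivalence.to T-∧ ok

parentsOK-∷ʳ : ∀ {m} (p : Vec ℕ m) x → T (parentsOK 0 (toList (p ∷ʳ x))) ⇔ (T (parentsOK 0 (toList p)) × x < suc m)
parentsOK-∷ʳ {m} p x rewrite toList-∷ʳ x p | parentsOK-++ 0 (toList p) x | length-toList p =
  mk⇔ (λ ok → let ok₁ , ok₂ = Equivalence.to T-∧ ok in ok₁ , <ᵇ⇒< x (suc m) ok₂)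
      (λ { (ok₁ , x<) → Equivalence.from T-∧ (ok₁ , <⇒<ᵇ x<) })

attach : ∀ {m} → IncTree m → Fin (suc m) → IncTree (suc m)
attach (p , ok) q = p ∷ʳ toℕ q , Equivalence.from (parentsOK-∷ʳ p (toℕ q)) (ok , Fin.toℕ<n q)

detach : ∀ {m} → IncTree (suc m) → IncTree m × Fin (suc m)
detach (p , ok) = (init p , proj₁ ok′) , fromℕ< (proj₂ ok′)
  where
  ok′ = Equivalence.to (parentsOK-∷ʳ (init p) (last p)) (subst (T ∘ parentsOK 0 ∘ toList) (proj₂ (proj₂ (initLast p))) ok)

IncTree-suc↔ : ∀ {m} → IncTree (suc m) ↔ (IncTree m × Fin (suc m))
IncTree-suc↔ = mk↔ₛ′ detach (uncurry attach) detach∘attach attach∘detach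
  where
  detach∘attach : ∀ tq → detach (uncurry attach tq) ≡ tq
  detach∘attach ((p , _) , q) =
    cong₂ _,_ (Σ-T-≡ (init-∷ʳ (toℕ q) p)) (Fin.toℕ-injective (trans (Fin.toℕ-fromℕ< _) (last-∷ʳ (toℕ q) p)))
  attach∘detach : ∀ t → uncurry attach (detach t) ≡ t
  attach∘detach (p , _) = Σ-T-≡ (trans (cong (init p ∷ʳ_) (Fin.toℕ-fromℕ< _)) (sym (proj₂ (proj₂ (initLast p)))))

degree-attach : ∀ {m} (t : IncTree m) q v → degree (attach t q) v ≡ ⟦ toℕ q ≡ᵇ v ⟧ + degree t v
degree-attach (p , _) q v = begin
  length (filter (_≟ v) (toList (p ∷ʳ toℕ q)))                         ≡⟨ cong (length ∘ filter (_≟ v)) (toList-∷ʳ (toℕ q) p) ⟩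
  length (filter (_≟ v) (toList p ++ [ toℕ q ]))                        ≡⟨ cong length (filter-++ (_≟ v) (toList p) [ toℕ q ]) ⟩
  length (filter (_≟ v) (toList p) ++ filter (_≟ v) [ toℕ q ])          ≡⟨ length-++ (filter (_≟ v) (toList p)) ⟩
  length (filter (_≟ v) (toList p)) + length (filter (_≟ v) [ toℕ q ])  ≡⟨ +-comm _ (length (filter (_≟ v) [ toℕ q ])) ⟩
  length (filter (_≟ v) [ toℕ q ]) + length (filter (_≟ v) (toList p))  ≡⟨ cong (_+ _) (length-filter-singleton (toℕ q)) ⟩
  ⟦ toℕ q ≡ᵇ v ⟧ + length (filter (_≟ v) (toList p))                    ∎
  where
  open ≡-Reasoning
  length-filter-singleton : ∀ u → length (filter (_≟ v) [ u ]) ≡ ⟦ u ≡ᵇ v ⟧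
  length-filter-singleton u with u ≡ᵇ v
  ... | true  = refl
  ... | false = refl

degree-last : ∀ {m} (t : IncTree m) → degree t m ≡ 0
degree-last {m} (p , ok) = cong length (filter-none (_≟ m) (All.map <⇒≢ parents<m))
  where
  parents<m : All (_< m) (toList p)
  parents<m = subst (λ n → All (_< n) (toList p)) (length-toList p) (parentsOK⇒All< 0 (toList p) ok)

evenAt : ∀ {m} → IncTree m → Fin m → Bool
evenAt t i = isEven (degree t (suc (toℕ i)))

length-filter-applyUpTo : ∀ (P : ℕ → Bool) f n →
  length (filter (λ v → P v ≟ᴮ true) (applyUpTo f n)) ≡ count (λ (i : Fin n) → P (f (toℕ i)))
length-filter-applyUpTo P f zero    = refl
length-filter-applyUpTo P f (suc n) with P (f 0)
... | true  = cong suc (length-filter-applyUpTo P (f ∘ suc) n)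
... | false = length-filter-applyUpTo P (f ∘ suc) n

evenNonroot≡count : ∀ {m} (t : IncTree m) → evenNonroot t ≡ count (evenAt t)
evenNonroot≡count {m} t =
  trans (cong (length ∘ filter _) (map-applyUpTo (λ x → x) suc m)) (length-filter-applyUpTo (λ v → isEven (degree t v)) suc m)

-- The new leaf is an even nonroot vertex, and its parent's degree changes parity.
treeGain : ∀ {m} → IncTree m → Fin (suc m) → Increment
treeGain t zero    = +1
treeGain t (suc j) = if evenAt t j then +0 else +2

evenAt-attach : ∀ {m} (t : IncTree m) q i →
                evenAt (attach t q) (inject₁ i) ≡ isEven (⟦ toℕ q ≡ᵇ suc (toℕ i) ⟧ + degree t (suc (toℕ i)))
evenAt-attach t q i =
  cong isEven (trans (cong (degree (attach t q) ∘ suc) (Fin.toℕ-inject₁ i)) (degree-attach t q (suc (toℕ i))))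

evenAt-attach-new : ∀ {m} (t : IncTree m) q → evenAt (attach t q) (fromℕ m) ≡ true
evenAt-attach-new {m} t q =
  cong isEven (trans (cong (degree (attach t q) ∘ suc) (Fin.toℕ-fromℕ m)) (degree-last (attach t q)))

count-evenAt-attach : ∀ {m} (t : IncTree m) q →
                      suc (count (evenAt (attach t q) ∘ inject₁)) ≡ value (treeGain t q) + count (evenAt t)
count-evenAt-attach t zero    = cong suc (count-cong (evenAt-attach t zero))
count-evenAt-attach {suc m} t (suc j) = begin
  suc (count (evenAt t′ ∘ inject₁))
    ≡⟨ cong suc (count-punchIn (evenAt t′ ∘ inject₁) j) ⟩
  suc (⟦ evenAt t′ (inject₁ j) ⟧ + count (evenAt t′ ∘ inject₁ ∘ punchIn j))
    ≡⟨ cong₂ (λ b c → suc (⟦ b ⟧ + c)) parent-flips (count-cong others-unchanged) ⟩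
  suc (⟦ not (evenAt t j) ⟧ + count (evenAt t ∘ punchIn j))
    ≡⟨ gain (evenAt t j) ⟩
  value (treeGain t (suc j)) + (⟦ evenAt t j ⟧ + count (evenAt t ∘ punchIn j))
    ≡⟨ cong (value (treeGain t (suc j)) +_) (sym (count-punchIn (evenAt t) j)) ⟩
  value (treeGain t (suc j)) + count (evenAt t)
    ∎
  where
  open ≡-Reasoning
  t′ = attach t (suc j)
  d = degree t (suc (toℕ j))
  parent-flips : evenAt t′ (inject₁ j) ≡ not (evenAt t j)
  parent-flips = trans (evenAt-attach t (suc j) j) (trans (cong (λ b → isEven (⟦ b ⟧ + d)) (≡ᵇ-refl (toℕ j))) (isEven-suc d))
  others-unchanged : ∀ i → evenAt t′ (inject₁ (punchIn j i)) ≡ evenAt t (punchIn j i)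
  others-unchanged i = trans (evenAt-attach t (suc j) (punchIn j i))
    (cong (λ b → isEven (⟦ b ⟧ + degree t (suc (toℕ (punchIn j i))))) (≢⇒≡ᵇ-false (Fin.punchInᵢ≢i j i ∘ sym)))
  gain : ∀ b → suc (⟦ not b ⟧ + count (evenAt t ∘ punchIn j)) ≡
               value (if b then +0 else +2) + (⟦ b ⟧ + count (evenAt t ∘ punchIn j))
  gain true  = refl
  gain false = refl

evenNonroot-attach : ∀ {m} (t : IncTree m) q → evenNonroot (attach t q) ≡ value (treeGain t q) + evenNonroot t
evenNonroot-attach {m} t q = begin
  evenNonroot t′                                ≡⟨ evenNonroot≡count t′ ⟩
  count (evenAt t′)                             ≡⟨ count-last (evenAt t′) ⟩
  count (evenAt t′ ∘ inject₁) + ⟦ evenAt t′ (fromℕ m) ⟧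
                                                ≡⟨ cong (λ b → count (evenAt t′ ∘ inject₁) + ⟦ b ⟧) (evenAt-attach-new t q) ⟩
  count (evenAt t′ ∘ inject₁) + 1               ≡⟨ +-comm _ 1 ⟩
  suc (count (evenAt t′ ∘ inject₁))             ≡⟨ count-evenAt-attach t q ⟩
  value (treeGain t q) + count (evenAt t)       ≡⟨ cong (value (treeGain t q) +_) (sym (evenNonroot≡count t)) ⟩
  value (treeGain t q) + evenNonroot t          ∎
  where
  open ≡-Reasoning
  t′ = attach t q

multiplicity-treeGain-+0 : ∀ {m} (t : IncTree m) → multiplicity (treeGain t) +0 ≡ evenNonroot t
multiplicity-treeGain-+0 t = trans (count-cong +0⇔even) (sym (evenNonroot≡count t))
  where
  +0⇔even : ∀ j → isValue (treeGain t) +0 (suc j) ≡ evenAt t j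
  +0⇔even j with evenAt t j
  ... | true  = refl
  ... | false = refl

multiplicity-treeGain-+1 : ∀ {m} (t : IncTree m) → multiplicity (treeGain t) +1 ≡ 1
multiplicity-treeGain-+1 t = cong suc (count-none _ only-root)
  where
  only-root : ∀ j → isValue (treeGain t) +1 (suc j) ≡ false
  only-root j with evenAt t j
  ... | true  = refl
  ... | false = refl

-- Turns of a word under insertion of a new maximum

-- Direction changes along l ∷ r, where d records whether the step into l is an ascent.
turns : Bool → ℕ → List ℕ → ℕ
turns d l []      = 0
turns d l (z ∷ r) = ⟦ not ((l <ᵇ z) == d) ⟧ + turns (l <ᵇ z) z r

length-go : ∀ d cur l rest → length (go d cur l rest) ≡ suc (turns d l rest)
length-go d cur l []       = refl
length-go d cur l (z ∷ rest) with l <ᵇ z | d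
... | true  | true  = length-go true (z ∷ cur) z rest
... | true  | false = cong suc (length-go true (z ∷ l ∷ []) z rest)
... | false | true  = cong suc (length-go false (z ∷ l ∷ []) z rest)
... | false | false = length-go false (z ∷ cur) z rest

insertAt : List ℕ → ℕ → ℕ → List ℕ
insertAt xs       zero    M = M ∷ xs
insertAt []       (suc k) M = M ∷ []
insertAt (x ∷ xs) (suc k) M = x ∷ insertAt xs k M

-- Change of turns when a new maximum is put between l and z, given the direction
-- into l, whether l < z, and the direction out of z if there is one.
betweenGain : Bool → Bool → Maybe Bool → Increment
betweenGain d     true  nothing      = +1
betweenGain d     true  (just true)  = +2
betweenGain d     true  (just false) = +0
betweenGain true  false _            = +0
betweenGain false false _            = +2

stepAfter : ℕ → List ℕ → Maybe Bool
stepAfter z []      = nothing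
stepAfter z (w ∷ _) = just (z <ᵇ w)

-- Slot k lies after the first k entries of rest; slots past the end act as the last one.
slotGain : Bool → ℕ → List ℕ → ℕ → Increment
slotGain d l []      k       = if d then +0 else +1
slotGain d l (z ∷ r) zero    = betweenGain d (l <ᵇ z) (stepAfter z r)
slotGain d l (z ∷ r) (suc k) = slotGain (l <ᵇ z) z r k

turns-insertAt-end : ∀ d l M → l < M → turns d l (M ∷ []) ≡ value (if d then +0 else +1) + 0
turns-insertAt-end d l M l<M rewrite <⇒<ᵇ≡true l<M with d
... | true  = refl
... | false = refl

turns-insertAt-between : ∀ d l z r M → l < M → z < M →
  turns d l (M ∷ z ∷ r) ≡ value (betweenGain d (l <ᵇ z) (stepAfter z r)) + turns d l (z ∷ r)
turns-insertAt-between d l z [] M l<M z<M rewrite <⇒<ᵇ≡true l<M | >⇒<ᵇ≡false z<M with l <ᵇ z | d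
... | true  | true  = refl
... | true  | false = refl
... | false | true  = refl
... | false | false = refl
turns-insertAt-between d l z (w ∷ r) M l<M z<M rewrite <⇒<ᵇ≡true l<M | >⇒<ᵇ≡false z<M =
  turns-near-M (l <ᵇ z) d (z <ᵇ w) (turns (z <ᵇ w) w r)
  where
  turns-near-M : ∀ a d b n → ⟦ not d ⟧ + (1 + (⟦ not (b == false) ⟧ + n)) ≡
                      value (betweenGain d a (just b)) + (⟦ not (a == d) ⟧ + (⟦ not (b == a) ⟧ + n))
  turns-near-M true  true  true  n = refl
  turns-near-M true  true  false n = refl
  turns-near-M true  false true  n = refl
  turns-near-M true  false false n = refl
  turns-near-M false true  true  n = refl
  turns-near-M false true  false n = refl
  turns-near-M false false true  n = refl
  turns-near-M false false false n = refl

turns-insertAt : ∀ d l rest k M → All (_< M) (l ∷ rest) →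
                 turns d l (insertAt rest k M) ≡ value (slotGain d l rest k) + turns d l rest
turns-insertAt d l []      zero    M (l<M ∷ [])        = turns-insertAt-end d l M l<M
turns-insertAt d l []      (suc k) M (l<M ∷ [])        = turns-insertAt-end d l M l<M
turns-insertAt d l (z ∷ r) zero    M (l<M ∷ z<M ∷ _)   = turns-insertAt-between d l z r M l<M z<M
turns-insertAt d l (z ∷ r) (suc k) M (_ ∷ rest<M)      = begin
  ⟦ b ⟧ + turns (l <ᵇ z) z (insertAt r k M)                     ≡⟨ cong (⟦ b ⟧ +_) (turns-insertAt (l <ᵇ z) z r k M rest<M) ⟩
  ⟦ b ⟧ + (value (slotGain (l <ᵇ z) z r k) + turns (l <ᵇ z) z r) ≡⟨ x∙yz≈y∙xz ⟦ b ⟧ (value (slotGain (l <ᵇ z) z r k)) _ ⟩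
  value (slotGain (l <ᵇ z) z r k) + (⟦ b ⟧ + turns (l <ᵇ z) z r) ∎
  where
  open ≡-Reasoning
  b = not ((l <ᵇ z) == d)

-- Indexed by an arbitrary Fin N so that the length of the word can be rewritten without casts.
slotGains : ∀ {N} → Bool → ℕ → List ℕ → Fin N → Increment
slotGains d l rest i = slotGain d l rest (toℕ i)

multiplicity-slotGains-resize : ∀ {N} d l rest c → length rest ≡ N →
  multiplicity (slotGains {suc N} d l rest) c ≡ multiplicity (slotGains {suc (length rest)} d l rest) c
multiplicity-slotGains-resize d l rest c refl = refl

multiplicity-slotGains-+1 : ∀ d l z r → multiplicity (slotGains {2 + length r} d l (z ∷ r)) +1 ≡ 1
multiplicity-slotGains-+1 d l z [] with l <ᵇ z | d
... | true  | true  = refl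
... | true  | false = refl
... | false | true  = refl
... | false | false = refl
multiplicity-slotGains-+1 d l z (w ∷ r) =
  cong₂ (λ b n → ⟦ b ⟧ + n) (no-+1 d (l <ᵇ z) (z <ᵇ w)) (multiplicity-slotGains-+1 (l <ᵇ z) z w r)
  where
  no-+1 : ∀ d a b → ⌊ betweenGain d a (just b) ≟ᴵ +1 ⌋ ≡ false
  no-+1 d     true  true  = refl
  no-+1 d     true  false = refl
  no-+1 true  false b     = refl
  no-+1 false false b     = refl

multiplicity-slotGains-+0 : ∀ d l z r → multiplicity (slotGains {2 + length r} d l (z ∷ r)) +0 ≡ ⟦ d ∧ (l <ᵇ z) ⟧ + turns d l (z ∷ r)
multiplicity-slotGains-+0 d l z [] with l <ᵇ z | d
... | true  | true  = refl
... | true  | false = refl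
... | false | true  = refl
... | false | false = refl
multiplicity-slotGains-+0 d l z (w ∷ r) =
  trans (cong (⟦ ⌊ betweenGain d (l <ᵇ z) (just (z <ᵇ w)) ≟ᴵ +0 ⌋ ⟧ +_) (multiplicity-slotGains-+0 (l <ᵇ z) z w r))
        (first-slot d (l <ᵇ z) (z <ᵇ w) (turns (z <ᵇ w) w r))
  where
  first-slot : ∀ d a b n → ⟦ ⌊ betweenGain d a (just b) ≟ᴵ +0 ⌋ ⟧ + (⟦ a ∧ b ⟧ + (⟦ not (b == a) ⟧ + n)) ≡
                      ⟦ d ∧ a ⟧ + (⟦ not (a == d) ⟧ + (⟦ not (b == a) ⟧ + n))
  first-slot true  true  true  n = refl
  first-slot true  true  false n = refl
  first-slot true  false true  n = refl
  first-slot true  false false n = refl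
  first-slot false true  true  n = refl
  first-slot false true  false n = refl
  first-slot false false true  n = refl
  first-slot false false false n = refl

-- Permutations

-- oneLine for rectangular vectors, so that it can recurse on the tail.
word : ∀ {a b} → Vec (Fin a) b → List ℕ
word v = List.map (λ i → suc (toℕ i)) (Vec.toList v)

elemᵇ-lookup : ∀ {a b} (v : Vec (Fin a) b) j → T (elemᵇ (suc (toℕ (lookup v j))) (word v))
elemᵇ-lookup (x ∷ v) zero    rewrite ≡ᵇ-refl (toℕ x) = _
elemᵇ-lookup (x ∷ v) (suc j) with toℕ (lookup v j) ≡ᵇ toℕ x
... | true  = _
... | false = elemᵇ-lookup v j

elemᵇ⇒lookup : ∀ {a b} (v : Vec (Fin a) b) x → T (elemᵇ (suc (toℕ x)) (word v)) → ∃ λ j → lookup v j ≡ x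
elemᵇ⇒lookup (y ∷ v) x x∈v with toℕ x ≡ᵇ toℕ y in x≡y
... | true  = zero , sym (Fin.toℕ-injective (≡ᵇ⇒≡ (toℕ x) (toℕ y) (Equivalence.from T-≡ x≡y)))
... | false = let j , vj≡x = elemᵇ⇒lookup v x x∈v in suc j , vj≡x

allDistinct⇒lookup-injective : ∀ {a b} (v : Vec (Fin a) b) → T (allDistinct (word v)) → Injective _≡_ _≡_ (lookup v)
allDistinct⇒lookup-injective (x ∷ v) ok {zero}  {zero}  _     = refl
allDistinct⇒lookup-injective (x ∷ v) ok {zero}  {suc j} x≡vj  =
  contradiction (subst (λ y → T (elemᵇ (suc (toℕ y)) (word v))) (sym x≡vj) (elemᵇ-lookup v j)) (T-not⇒¬T (proj₁ (Equivalence.to T-∧ ok)))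
allDistinct⇒lookup-injective (x ∷ v) ok {suc i} {zero}  vi≡x  =
  contradiction (subst (λ y → T (elemᵇ (suc (toℕ y)) (word v))) vi≡x (elemᵇ-lookup v i)) (T-not⇒¬T (proj₁ (Equivalence.to T-∧ ok)))
allDistinct⇒lookup-injective (x ∷ v) ok {suc i} {suc j} vi≡vj =
  cong suc (allDistinct⇒lookup-injective v (proj₂ (Equivalence.to T-∧ ok)) vi≡vj)

lookup-injective⇒allDistinct : ∀ {a b} (v : Vec (Fin a) b) → Injective _≡_ _≡_ (lookup v) → T (allDistinct (word v))
lookup-injective⇒allDistinct []      _   = _
lookup-injective⇒allDistinct (x ∷ v) inj with elemᵇ (suc (toℕ x)) (word v) in x∈v
... | true  = let j , vj≡x = elemᵇ⇒lookup v x (Equivalence.from T-≡ x∈v) in contradiction (inj {zero} {suc j} (sym vj≡x)) λ ()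
... | false = lookup-injective⇒allDistinct v (Fin.suc-injective ∘ inj)

insertMaxᵛ : ∀ {m} → Vec (Fin m) m → Fin (suc m) → Vec (Fin (suc m)) (suc m)
insertMaxᵛ {m} w p = Vec.insertAt (Vec.map inject₁ w) p (fromℕ m)

lookup-insertMaxᵛ-punchIn : ∀ {m} (w : Vec (Fin m) m) p j → lookup (insertMaxᵛ w p) (punchIn p j) ≡ inject₁ (lookup w j)
lookup-insertMaxᵛ-punchIn w p j = trans (insertAt-punchIn (Vec.map inject₁ w) p _ j) (lookup-map j inject₁ w)

insertMaxᵛ-injective : ∀ {m} (w : Vec (Fin m) m) p → Injective _≡_ _≡_ (lookup w) → Injective _≡_ _≡_ (lookup (insertMaxᵛ w p))
insertMaxᵛ-injective w p inj {i} {k} eq with punchIn-cases p i | punchIn-cases p k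
... | inj₁ refl        | inj₁ refl        = refl
... | inj₁ refl        | inj₂ (b , refl)  =
  contradiction (trans (sym (insertAt-lookup _ p _)) (trans eq (lookup-insertMaxᵛ-punchIn w p b))) Fin.fromℕ≢inject₁
... | inj₂ (a , refl)  | inj₁ refl        =
  contradiction (trans (sym (insertAt-lookup _ p _)) (trans (sym eq) (lookup-insertMaxᵛ-punchIn w p a))) Fin.fromℕ≢inject₁
... | inj₂ (a , refl)  | inj₂ (b , refl)  =
  cong (punchIn p) (inj (Fin.inject₁-injective (trans (sym (lookup-insertMaxᵛ-punchIn w p a)) (trans eq (lookup-insertMaxᵛ-punchIn w p b)))))

maxPosition : ∀ {m} (v : Vec (Fin (suc m)) (suc m)) → Injective _≡_ _≡_ (lookup v) → ∃ λ q → lookup v q ≡ fromℕ m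
maxPosition {m} v inj =
  let q , _ , max≤vq = Fin.injective⇒existsPivot inj (fromℕ m) in q , Fin.≤-antisym (Fin.≤fromℕ (lookup v q)) max≤vq

module _ {m} (v : Vec (Fin (suc m)) (suc m)) (inj : Injective _≡_ _≡_ (lookup v)) {q} (vq≡max : lookup v q ≡ fromℕ m) where

  lookup-punchIn≢max : ∀ i → m ≢ toℕ (lookup v (punchIn q i))
  lookup-punchIn≢max i m≡vi =
    Fin.punchInᵢ≢i q i (inj (trans (Fin.toℕ-injective (trans (sym m≡vi) (sym (Fin.toℕ-fromℕ m)))) (sym vq≡max)))

  removeMaxᵛ : Vec (Fin m) m
  removeMaxᵛ = tabulate (λ i → lower₁ (lookup v (punchIn q i)) (lookup-punchIn≢max i))

  inject₁-lookup-removeMaxᵛ : ∀ i → inject₁ (lookup removeMaxᵛ i) ≡ lookup v (punchIn q i)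
  inject₁-lookup-removeMaxᵛ i = trans (cong inject₁ (lookup∘tabulate _ i)) (Fin.inject₁-lower₁ _ (lookup-punchIn≢max i))

  removeMaxᵛ-injective : Injective _≡_ _≡_ (lookup removeMaxᵛ)
  removeMaxᵛ-injective {i} {j} eq = Fin.punchIn-injective q i j
    (inj (trans (sym (inject₁-lookup-removeMaxᵛ i)) (trans (cong inject₁ eq) (inject₁-lookup-removeMaxᵛ j))))

  insertMaxᵛ-removeMaxᵛ : insertMaxᵛ removeMaxᵛ q ≡ v
  insertMaxᵛ-removeMaxᵛ = lookup-extensionality _ _ λ k → case punchIn-cases q k of λ where
    (inj₁ refl)       → trans (insertAt-lookup _ q _) (sym vq≡max)
    (inj₂ (j , refl)) → trans (lookup-insertMaxᵛ-punchIn removeMaxᵛ q j) (inject₁-lookup-removeMaxᵛ j)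

removeMaxᵛ-insertMaxᵛ : ∀ {m} (w : Vec (Fin m) m) p (inj : Injective _≡_ _≡_ (lookup (insertMaxᵛ w p))) →
                        ∀ {q} (uq≡max : lookup (insertMaxᵛ w p) q ≡ fromℕ m) → q ≡ p →
                        removeMaxᵛ (insertMaxᵛ w p) inj uq≡max ≡ w
removeMaxᵛ-insertMaxᵛ w p inj {q} uq≡max q≡p = lookup-extensionality _ _ λ i → Fin.inject₁-injective (begin
  inject₁ (lookup (removeMaxᵛ (insertMaxᵛ w p) inj uq≡max) i) ≡⟨ inject₁-lookup-removeMaxᵛ (insertMaxᵛ w p) inj uq≡max i ⟩
  lookup (insertMaxᵛ w p) (punchIn q i)         ≡⟨ cong (λ q → lookup (insertMaxᵛ w p) (punchIn q i)) q≡p ⟩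
  lookup (insertMaxᵛ w p) (punchIn p i)         ≡⟨ lookup-insertMaxᵛ-punchIn w p i ⟩
  inject₁ (lookup w i)                          ∎)
  where open ≡-Reasoning

insertMax : ∀ {m} → Perm m → Fin (suc m) → Perm (suc m)
insertMax (w , ok) p =
  insertMaxᵛ w p , lookup-injective⇒allDistinct (insertMaxᵛ w p) (insertMaxᵛ-injective w p (allDistinct⇒lookup-injective w ok))

removeMax : ∀ {m} → Perm (suc m) → Perm m × Fin (suc m)
removeMax (v , ok) = (w , lookup-injective⇒allDistinct w (removeMaxᵛ-injective v inj vq≡max)) , q
  where
  inj = allDistinct⇒lookup-injective v ok
  q = proj₁ (maxPosition v inj)
  vq≡max = proj₂ (maxPosition v inj)
  w = removeMaxᵛ v inj vq≡max

Perm-suc↔ : ∀ {m} → Perm (suc m) ↔ (Perm m × Fin (suc m))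
Perm-suc↔ = mk↔ₛ′ removeMax (uncurry insertMax) removeMax∘insertMax insertMax∘removeMax
  where
  removeMax∘insertMax : ∀ σp → removeMax (uncurry insertMax σp) ≡ σp
  removeMax∘insertMax ((w , ok) , p) =
    cong₂ _,_ (Σ-T-≡ (removeMaxᵛ-insertMaxᵛ w p inj uq≡max q≡p)) q≡p
    where
    inj : Injective _≡_ _≡_ (lookup (insertMaxᵛ w p))
    inj = allDistinct⇒lookup-injective (insertMaxᵛ w p) (proj₂ (insertMax (w , ok) p))
    uq≡max = proj₂ (maxPosition (insertMaxᵛ w p) inj)
    q≡p = inj (trans uq≡max (sym (insertAt-lookup (Vec.map inject₁ w) p _)))
  insertMax∘removeMax : ∀ σ → uncurry insertMax (removeMax σ) ≡ σ
  insertMax∘removeMax (v , ok) = Σ-T-≡ (insertMaxᵛ-removeMaxᵛ v inj (proj₂ (maxPosition v inj)))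
    where inj = allDistinct⇒lookup-injective v ok

word-map-inject₁ : ∀ {m k} (xs : Vec (Fin m) k) → word (Vec.map inject₁ xs) ≡ word xs
word-map-inject₁ []       = refl
word-map-inject₁ (x ∷ xs) = cong₂ _∷_ (cong suc (Fin.toℕ-inject₁ x)) (word-map-inject₁ xs)

word-insertAt-max : ∀ {m k} (xs : Vec (Fin m) k) p →
                    word (Vec.insertAt (Vec.map inject₁ xs) p (fromℕ m)) ≡ insertAt (word xs) (toℕ p) (suc m)
word-insertAt-max {m} xs       zero    = cong₂ _∷_ (cong suc (Fin.toℕ-fromℕ m)) (word-map-inject₁ xs)
word-insertAt-max     (x ∷ xs) (suc p) = cong₂ _∷_ (cong suc (Fin.toℕ-inject₁ x)) (word-insertAt-max xs p)

word-bounded : ∀ {m k} (xs : Vec (Fin m) k) → All (_< suc m) (word xs)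
word-bounded []       = []
word-bounded (x ∷ xs) = s≤s (Fin.toℕ<n x) ∷ word-bounded xs

length-word : ∀ {m k} (xs : Vec (Fin m) k) → length (word xs) ≡ k
length-word xs = trans (length-map _ (Vec.toList xs)) (length-toList xs)

runCount≡suc-turns : ∀ {m} (σ : Perm (suc m)) → runCount σ ≡ suc (turns true 0 (oneLine (proj₁ σ)))
runCount≡suc-turns (x ∷ v , _) = length-go true (suc (toℕ x) ∷ 0 ∷ []) (suc (toℕ x)) (word v)

permGain : ∀ {m} → Perm m → Fin (suc m) → Increment
permGain (w , _) = slotGains true 0 (word w)

runCount-insertMax : ∀ {m} (σ : Perm (suc m)) p → runCount (insertMax σ p) ≡ value (permGain σ p) + runCount σ
runCount-insertMax {m} σ@(w , _) p = begin
  runCount (insertMax σ p)                                     ≡⟨ runCount≡suc-turns (insertMax σ p) ⟩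
  suc (turns true 0 (word (insertMaxᵛ w p)))                   ≡⟨ cong (suc ∘ turns true 0) (word-insertAt-max w p) ⟩
  suc (turns true 0 (insertAt (word w) (toℕ p) (suc (suc m))))
    ≡⟨ cong suc (turns-insertAt true 0 (word w) (toℕ p) (suc (suc m)) (z<s ∷ word-bounded w)) ⟩
  suc (value (permGain σ p) + turns true 0 (word w))           ≡⟨ sym (+-suc (value (permGain σ p)) _) ⟩
  value (permGain σ p) + suc (turns true 0 (word w))           ≡⟨ cong (value (permGain σ p) +_) (sym (runCount≡suc-turns σ)) ⟩
  value (permGain σ p) + runCount σ                            ∎
  where open ≡-Reasoning

multiplicity-permGain-+0 : ∀ {m} (σ : Perm (suc m)) → multiplicity (permGain σ) +0 ≡ runCount σ
multiplicity-permGain-+0 σ@(x ∷ w , _) = begin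
  multiplicity (permGain σ) +0
    ≡⟨ multiplicity-slotGains-resize true 0 (word (x ∷ w)) +0 (length-word (x ∷ w)) ⟩
  multiplicity (slotGains {2 + length (word w)} true 0 (suc (toℕ x) ∷ word w)) +0
    ≡⟨ multiplicity-slotGains-+0 true 0 (suc (toℕ x)) (word w) ⟩
  suc (turns true 0 (word (x ∷ w)))                          ≡⟨ sym (runCount≡suc-turns σ) ⟩
  runCount σ                                                 ∎
  where open ≡-Reasoning

multiplicity-permGain-+1 : ∀ {m} (σ : Perm (suc m)) → multiplicity (permGain σ) +1 ≡ 1
multiplicity-permGain-+1 (x ∷ w , _) =
  trans (multiplicity-slotGains-resize true 0 (word (x ∷ w)) +1 (length-word (x ∷ w)))
        (multiplicity-slotGains-+1 true 0 (suc (toℕ x)) (word w))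

-- The bijection

RunEvenBijection : ℕ → Set
RunEvenBijection n = Σ[ φ ∈ Perm n ↔ IncTree n ] (∀ σ → runCount σ ≡ evenNonroot (Inverse.to φ σ))

-- The induction starts at 1: for the empty word runCount is 0, not 1 + turns.
runEvenBijection-1 : RunEvenBijection 1
runEvenBijection-1 = mk↔ₛ′ (λ _ → 0 ∷ [] , _) (λ _ → zero ∷ [] , _) unique-tree unique-perm , λ { (zero ∷ [] , _) → refl }
  where
  unique-tree : ∀ (t : IncTree 1) → (0 ∷ [] , _) ≡ t
  unique-tree (zero ∷ [] , _) = refl
  unique-perm : ∀ (σ : Perm 1) → (zero ∷ [] , _) ≡ σ
  unique-perm (zero ∷ [] , _) = refl

runEvenBijection-suc : ∀ {m} → RunEvenBijection (suc m) → RunEvenBijection (suc (suc m))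
runEvenBijection-suc {m} (ψ , runs≡even) = φ , runs≡even′
  where
  open Inverse ψ using (to)
  same-gains : ∀ σ c → multiplicity (permGain σ) c ≡ multiplicity (treeGain (to σ)) c
  same-gains σ = same-multiplicities (permGain σ) (treeGain (to σ))
    (trans (multiplicity-permGain-+0 σ) (trans (runs≡even σ) (sym (multiplicity-treeGain-+0 (to σ)))))
    (trans (multiplicity-permGain-+1 σ) (sym (multiplicity-treeGain-+1 (to σ))))
  π : Perm (suc m) → Permutation′ (suc (suc m))
  π σ = proj₁ (rearrangement (permGain σ) (treeGain (to σ)) (same-gains σ))
  matches : ∀ σ p → treeGain (to σ) (π σ ⟨$⟩ʳ p) ≡ permGain σ p
  matches σ = proj₂ (rearrangement (permGain σ) (treeGain (to σ)) (same-gains σ))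
  φ : Perm (suc (suc m)) ↔ IncTree (suc (suc m))
  φ = ↔-trans Perm-suc↔ (↔-trans (Σ-↔ ψ (λ {σ} → π σ)) (↔-sym IncTree-suc↔))
  runs≡even′ : ∀ σ′ → runCount σ′ ≡ evenNonroot (Inverse.to φ σ′)
  runs≡even′ σ′ = begin
    runCount σ′                                              ≡⟨ cong runCount (sym (Inverse.strictlyInverseʳ Perm-suc↔ σ′)) ⟩
    runCount (insertMax σ p)                                 ≡⟨ runCount-insertMax σ p ⟩
    value (permGain σ p) + runCount σ                        ≡⟨ cong₂ _+_ (cong value (sym (matches σ p))) (runs≡even σ) ⟩
    value (treeGain (to σ) (π σ ⟨$⟩ʳ p)) + evenNonroot (to σ) ≡⟨ sym (evenNonroot-attach (to σ) (π σ ⟨$⟩ʳ p)) ⟩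
    evenNonroot (attach (to σ) (π σ ⟨$⟩ʳ p))                 ∎
    where
    open ≡-Reasoning
    σ = proj₁ (removeMax σ′)
    p = proj₂ (removeMax σ′)

runEvenBijection : ∀ m → RunEvenBijection (suc m)
runEvenBijection zero    = runEvenBijection-1
runEvenBijection (suc m) = runEvenBijection-suc (runEvenBijection m)

theorem5p1 : (n : ℕ) → 1 ≤ n →
    Σ[ φ ∈ Perm n ⤖ IncTree n ] ((σ : Perm n) → runCount σ ≡ evenNonroot (Bijection.to φ σ))
theorem5p1 (suc m) _ = ↔⇒⤖ (proj₁ (runEvenBijection m)) , proj₂ (runEvenBijection m)
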